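{- Let $X=\{a_1,\dots,a_n\}$, let $\mathcal{F}$ be a union-closed family of subsets of $X$ with $\bigcup_{f\in\mathcal{F}}f=X$, let $w=a_1\cdots a_n$ and $\mathcal{U}=\varphi_w(\mathcal{F})$. Then for each $f\in\mathcal{F}$, $\varphi_w$ restricts to a bijection $$\varphi_w:\mathcal{F}[f]\to\mathcal{U}[f],$$ where $\mathcal{F}[f]=\{g\in\mathcal{F}:f\subseteq g\}$ and $\mathcal{U}[f]=\{\eta\in\mathcal{U}:f\subseteq\eta\}$.
   Context: Union-closed: $f,g\in\mathcal{F}\Rightarrow f\cup g\in\mathcal{F}$. Rising functions: for $T\subseteq 2^X$ and $a\in X$, $\varphi_{T,a}:T\to2^X$ is $\varphi_{T,a}(z)=z\cup\{a\}$ if $z\cup\{a\}\notin T$, and $\varphi_{T,a}(z)=z$ otherwise. With $\varphi_0=\mathrm{id}$, $\mathcal{F}_0=\mathcal{F}$, and for $1\le j\le n$, $\varphi_j=\varphi_{\mathcal{F}_{j-1},a_j}\circ\varphi_{j-1}$, $\mathcal{F}_j=\varphi_j(\mathcal{F})$, the rising function with respect to $w$ is $\varphi_w=\varphi_n:\mathcal{F}\to2^X$. -}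

module Defs where

open import Data.Nat using (ℕ)
open import Data.Fin using (Fin)
open import Data.Fin.Subset using (Subset; _∪_; ⁅_⁆)
open import Data.Bool using (if_then_else_)
import Data.Bool as B
open import Data.List using (List; []; _∷_; map)
open import Data.List.Membership.Propositional using (_∈_)
open import Data.Vec.Properties using (≡-dec)
open import Relation.Binary.PropositionalEquality using (_≡_)
open import Relation.Binary.Definitions using (DecidableEquality)
import Relation.Nullary.Decidable
open import Relation.Nullary.Decidable using (⌊_⌋)
open import Function using (id; _∘_)
import Data.List.Membership.DecPropositional as DecMem

_≟ˢ_ : ∀ {n} → DecidableEquality (Subset n)
_≟ˢ_ = ≡-dec B._≟_

Family : ℕ → Set
Family n = List (Subset n)

UnionClosed : ∀ {n} → Family n → Set
UnionClosed F = ∀ {f g} → f ∈ F → g ∈ F → (f ∪ g) ∈ F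

_∈?ˢ_ : ∀ {n} → (x : Subset n) → (T : Family n) → Relation.Nullary.Decidable.Dec (x ∈ T)
_∈?ˢ_ {n} x T = DecMem._∈?_ _≟ˢ_ x T

rise : ∀ {n} → Family n → Fin n → Subset n → Subset n
rise T a z = if ⌊ (z ∪ ⁅ a ⁆) ∈?ˢ T ⌋ then z else (z ∪ ⁅ a ⁆)

-- Iterate along a word: given φ_{j-1} (as g), φ_j = φ_{φ_{j-1}(F), a_j} ∘ φ_{j-1}.
risingFrom : ∀ {n} → Family n → (Subset n → Subset n) → List (Fin n) → Subset n → Subset n
risingFrom F g []       = g
risingFrom F g (a ∷ as) = risingFrom F (rise (map g F) a ∘ g) as

risingW : ∀ {n} → Family n → List (Fin n) → Subset n → Subset n
risingW F w = risingFrom F id w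

image : ∀ {n} → (Subset n → Subset n) → Family n → Family n
image φ F = map φ F

module Submission where

-- The rising function φ_w is built one letter at a time:
-- φ_j = ρ_j ∘ φ_{j-1}, where ρ_j = rise T a_j is the single rising step on
-- the current image T = φ_{j-1}(F).  We isolate five properties of a map
-- g : 2^X → 2^X relative to F (the record RisingInvariant): g(F) is
-- union-closed, g z ∪ f ∈ g(F) for z, f ∈ F, g is injective on F, g is
-- extensive (z ⊆ g z), and g reflects inclusions of members of F
-- (f ⊆ g z implies f ⊆ z).  The identity has them when F is union-closed,
-- and each follows for ρ ∘ g from the corresponding one-step fact about a
-- single rise on a union-closed family (module OneRise).  Hence φ_w has all
-- five for every word w; the theorem reads them off: extensivity maps F[f]
-- into U[f], injectivity gives injectivity, and reflection gives
-- surjectivity onto U[f].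

open import Defs
open import Data.Nat using (ℕ)
open import Data.Fin using (Fin)
open import Data.Fin.Subset using (Subset; _⊆_; ⋃; ⊤)
open import Data.List using (List; allFin)
open import Data.List.Membership.Propositional using (_∈_)
open import Data.Product using (Σ; _×_)
open import Relation.Binary.PropositionalEquality using (_≡_)

open import Data.Fin.Subset using (_∪_; ⁅_⁆; _∉_) renaming (_∈_ to _∈ₛ_)
open import Data.Fin.Subset.Properties
  using (_∈?_; ⊆-antisym; ⊆-refl; ⊆-trans; p⊆p∪q; q⊆p∪q; x∈p∪q⁻; x∈⁅y⁆⇒x≡y; x∈⁅x⁆;
         ∪-assoc; ∪-commutativeMonoid; ∪-idempotentCommutativeMonoid)
open import Algebra.Bundles using (CommutativeMonoid)
import Algebra.Properties.CommutativeSemigroup as CommutativeSemigroupProperties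
import Algebra.Properties.IdempotentCommutativeMonoid as IdempotentCommutativeMonoidProperties
open import Data.List using ([]; _∷_; map)
open import Data.List.Properties using (map-∘; map-id)
open import Data.List.Membership.Propositional.Properties using (∈-map⁺; ∈-map⁻)
open import Data.Product using (_,_)
open import Data.Sum using (_⊎_; inj₁; inj₂)
open import Data.Empty using (⊥-elim)
open import Relation.Nullary using (¬_; yes; no)
open import Relation.Binary.PropositionalEquality using (refl; sym; trans; subst)
open import Function using (id; _∘_)

module ∪-Comm {n : ℕ} =
  CommutativeSemigroupProperties (CommutativeMonoid.commutativeSemigroup (∪-commutativeMonoid n))
module ∪-Idem {n : ℕ} =
  IdempotentCommutativeMonoidProperties (∪-idempotentCommutativeMonoid n)

module _ {n : ℕ} where

  ∪-least : {p q r : Subset n} → p ⊆ r → q ⊆ r → p ∪ q ⊆ r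
  ∪-least {p} {q} p⊆r q⊆r x∈p∪q with x∈p∪q⁻ p q x∈p∪q
  ... | inj₁ x∈p = p⊆r x∈p
  ... | inj₂ x∈q = q⊆r x∈q

  ⁅x⁆⊆p : {x : Fin n} {p : Subset n} → x ∈ₛ p → ⁅ x ⁆ ⊆ p
  ⁅x⁆⊆p {x} {p} x∈p y∈⁅x⁆ = subst (_∈ₛ p) (sym (x∈⁅y⁆⇒x≡y x y∈⁅x⁆)) x∈p

  ∪⁅x⁆-absorb : {x : Fin n} {p : Subset n} → x ∈ₛ p → p ∪ ⁅ x ⁆ ≡ p
  ∪⁅x⁆-absorb {x} {p} x∈p = ⊆-antisym (∪-least ⊆-refl (⁅x⁆⊆p x∈p)) (p⊆p∪q ⁅ x ⁆)

  ⊆∪⁅x⁆-split : {x : Fin n} {p q : Subset n} → q ⊆ p ∪ ⁅ x ⁆ → x ∈ₛ q ⊎ q ⊆ p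
  ⊆∪⁅x⁆-split {x} {p} {q} q⊆p∪x with x ∈? q
  ... | yes x∈q = inj₁ x∈q
  ... | no  x∉q = inj₂ q⊆p
    where
    q⊆p : q ⊆ p
    q⊆p {y} y∈q with x∈p∪q⁻ p ⁅ x ⁆ (q⊆p∪x y∈q)
    ... | inj₁ y∈p = y∈p
    ... | inj₂ y∈⁅x⁆ = ⊥-elim (x∉q (subst (_∈ₛ q) (x∈⁅y⁆⇒x≡y x y∈⁅x⁆) y∈q))

  ∪⁅x⁆-cancel-⊆ : {x : Fin n} {p q : Subset n} → x ∉ p → p ∪ ⁅ x ⁆ ≡ q ∪ ⁅ x ⁆ → p ⊆ q
  ∪⁅x⁆-cancel-⊆ {x} {p} {q} x∉p e with ⊆∪⁅x⁆-split (subst (p ⊆_) e (p⊆p∪q ⁅ x ⁆))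
  ... | inj₁ x∈p = ⊥-elim (x∉p x∈p)
  ... | inj₂ p⊆q = p⊆q

  ∪⁅x⁆-cancel : {x : Fin n} {p q : Subset n} → x ∉ p → x ∉ q → p ∪ ⁅ x ⁆ ≡ q ∪ ⁅ x ⁆ → p ≡ q
  ∪⁅x⁆-cancel x∉p x∉q e = ⊆-antisym (∪⁅x⁆-cancel-⊆ x∉p e) (∪⁅x⁆-cancel-⊆ x∉q (sym e))

module OneRise {n : ℕ} (T : Family n) (a : Fin n) where

  A : Subset n
  A = ⁅ a ⁆

  ρ : Subset n → Subset n
  ρ = rise T a

  R : Family n
  R = map ρ T

  data RiseView (z : Subset n) : Set where
    stays : (z ∪ A) ∈ T → ρ z ≡ z → RiseView z
    moves : ¬ (z ∪ A) ∈ T → ρ z ≡ z ∪ A → RiseView z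

  ρ-stays : {z : Subset n} → (z ∪ A) ∈ T → ρ z ≡ z
  ρ-stays {z} z∪a∈T with (z ∪ A) ∈?ˢ T
  ... | yes _     = refl
  ... | no z∪a∉T = ⊥-elim (z∪a∉T z∪a∈T)

  ρ-moves : {z : Subset n} → ¬ (z ∪ A) ∈ T → ρ z ≡ z ∪ A
  ρ-moves {z} z∪a∉T with (z ∪ A) ∈?ˢ T
  ... | yes z∪a∈T = ⊥-elim (z∪a∉T z∪a∈T)
  ... | no _      = refl

  riseView : (z : Subset n) → RiseView z
  riseView z with (z ∪ A) ∈?ˢ T
  ... | yes z∪a∈T = stays z∪a∈T (ρ-stays z∪a∈T)
  ... | no  z∪a∉T = moves z∪a∉T (ρ-moves z∪a∉T)

  stays∈R : {t : Subset n} → t ∈ T → (t ∪ A) ∈ T → t ∈ R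
  stays∈R {t} t∈T t∪a∈T with riseView t
  ... | stays _ ρt≡t = subst (_∈ R) ρt≡t (∈-map⁺ ρ t∈T)
  ... | moves t∪a∉T _ = ⊥-elim (t∪a∉T t∪a∈T)

  -- For every member t of T, the set t ∪ {a} belongs to the image R:
  -- it is either ρ t itself or a member of T containing a, hence fixed by ρ.
  added∈R : {t : Subset n} → t ∈ T → (t ∪ A) ∈ R
  added∈R {t} t∈T with riseView t
  ... | moves _ ρt≡t∪a = subst (_∈ R) ρt≡t∪a (∈-map⁺ ρ t∈T)
  ... | stays t∪a∈T _ =
    stays∈R t∪a∈T (subst (_∈ T) (sym (∪⁅x⁆-absorb (q⊆p∪q t A (x∈⁅x⁆ a)))) t∪a∈T)

  moves⇒∉ : {z : Subset n} → z ∈ T → ¬ (z ∪ A) ∈ T → a ∉ z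
  moves⇒∉ z∈T z∪a∉T a∈z = z∪a∉T (subst (_∈ T) (sym (∪⁅x⁆-absorb a∈z)) z∈T)

  ρ-extensive : (z : Subset n) → z ⊆ ρ z
  ρ-extensive z with riseView z
  ... | stays _ ρz≡z = subst (z ⊆_) (sym ρz≡z) ⊆-refl
  ... | moves _ ρz≡z∪a = subst (z ⊆_) (sym ρz≡z∪a) (p⊆p∪q A)

  -- ρ is injective on T: a moved set never equals a member of T, and two
  -- moved sets both avoid a, so adding a to them is injective.
  ρ-injective : {u v : Subset n} → u ∈ T → v ∈ T → ρ u ≡ ρ v → u ≡ v
  ρ-injective {u} {v} u∈T v∈T e with riseView u | riseView v
  ... | stays _ ρu≡u | stays _ ρv≡v = trans (sym ρu≡u) (trans e ρv≡v)
  ... | stays _ ρu≡u | moves v∪a∉T ρv≡v∪a =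
    ⊥-elim (v∪a∉T (subst (_∈ T) (trans (sym ρu≡u) (trans e ρv≡v∪a)) u∈T))
  ... | moves u∪a∉T ρu≡u∪a | stays _ ρv≡v =
    ⊥-elim (u∪a∉T (subst (_∈ T) (trans (sym ρv≡v) (trans (sym e) ρu≡u∪a)) v∈T))
  ... | moves u∪a∉T ρu≡u∪a | moves v∪a∉T ρv≡v∪a =
    ∪⁅x⁆-cancel (moves⇒∉ u∈T u∪a∉T) (moves⇒∉ v∈T v∪a∉T)
      (trans (sym ρu≡u∪a) (trans e ρv≡v∪a))

  -- Rising preserves union-closedness: ρ u ∪ ρ v is u ∪ v when both stay
  -- (and then u ∪ v stays), and (u ∪ v) ∪ {a} otherwise.
  ρ-∪∈R : UnionClosed T → {u v : Subset n} → u ∈ T → v ∈ T → (ρ u ∪ ρ v) ∈ R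
  ρ-∪∈R closed {u} {v} u∈T v∈T with closed u∈T v∈T | riseView u | riseView v
  ... | u∪v∈T | stays u∪a∈T ρu≡u | stays _ ρv≡v rewrite ρu≡u | ρv≡v =
    stays∈R u∪v∈T (subst (_∈ T) (∪-Comm.xy∙z≈xz∙y u A v) (closed u∪a∈T v∈T))
  ... | u∪v∈T | stays _ ρu≡u | moves _ ρv≡v∪a rewrite ρu≡u | ρv≡v∪a =
    subst (_∈ R) (∪-assoc u v A) (added∈R u∪v∈T)
  ... | u∪v∈T | moves _ ρu≡u∪a | stays _ ρv≡v rewrite ρu≡u∪a | ρv≡v =
    subst (_∈ R) (∪-Comm.xy∙z≈xz∙y u v A) (added∈R u∪v∈T)
  ... | u∪v∈T | moves _ ρu≡u∪a | moves _ ρv≡v∪a rewrite ρu≡u∪a | ρv≡v∪a =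
    subst (_∈ R) (∪-Idem.∙-distrʳ-∙ A u v) (added∈R u∪v∈T)

  ρ-closed : UnionClosed T → UnionClosed R
  ρ-closed closed u′∈R v′∈R with ∈-map⁻ ρ u′∈R | ∈-map⁻ ρ v′∈R
  ... | u , u∈T , refl | v , v∈T , refl = ρ-∪∈R closed u∈T v∈T

  -- If y ∪ f ∈ T then ρ y ∪ f ∈ R: when y stays, y ∪ f stays too;
  -- when y moves, ρ y ∪ f = (y ∪ f) ∪ {a}.
  ρ-∪-absorbed : UnionClosed T → {y f : Subset n} → (y ∪ f) ∈ T → (ρ y ∪ f) ∈ R
  ρ-∪-absorbed closed {y} {f} y∪f∈T with riseView y
  ... | stays y∪a∈T ρy≡y rewrite ρy≡y =
    stays∈R y∪f∈T (subst (_∈ T) y∪a∪y∪f≡y∪f∪a (closed y∪a∈T y∪f∈T))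
    where
    y∪a∪y∪f≡y∪f∪a : (y ∪ A) ∪ (y ∪ f) ≡ (y ∪ f) ∪ A
    y∪a∪y∪f≡y∪f∪a = trans (sym (∪-Idem.∙-distrˡ-∙ y A f)) (∪-Comm.x∙yz≈xz∙y y A f)
  ... | moves _ ρy≡y∪a rewrite ρy≡y∪a =
    subst (_∈ R) (∪-Comm.xy∙z≈xz∙y y f A) (added∈R y∪f∈T)

  -- ρ reflects inclusions: if y ∪ f ∈ T and f ⊆ ρ y then f ⊆ y.  Otherwise
  -- y moves and a ∈ f ⊆ y ∪ {a}, so y ∪ {a} = y ∪ f ∈ T, a contradiction.
  ρ-reflects-⊆ : {y f : Subset n} → (y ∪ f) ∈ T → f ⊆ ρ y → f ⊆ y
  ρ-reflects-⊆ {y} {f} y∪f∈T f⊆ρy with riseView y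
  ... | stays _ ρy≡y = subst (f ⊆_) ρy≡y f⊆ρy
  ... | moves y∪a∉T ρy≡y∪a rewrite ρy≡y∪a with ⊆∪⁅x⁆-split f⊆ρy
  ...   | inj₂ f⊆y = f⊆y
  ...   | inj₁ a∈f = ⊥-elim (y∪a∉T (subst (_∈ T) y∪f≡y∪a y∪f∈T))
    where
    y∪f≡y∪a : y ∪ f ≡ y ∪ A
    y∪f≡y∪a = ⊆-antisym (∪-least (p⊆p∪q A) f⊆ρy)
                        (∪-least (p⊆p∪q f) (⊆-trans (⁅x⁆⊆p a∈f) (q⊆p∪q y f)))

record RisingInvariant {n : ℕ} (F : Family n) (g : Subset n → Subset n) : Set where
  field
    closed     : UnionClosed (map g F)
    absorbs    : ∀ {z f} → z ∈ F → f ∈ F → (g z ∪ f) ∈ map g F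
    injective  : ∀ {z w} → z ∈ F → w ∈ F → g z ≡ g w → z ≡ w
    reflects-⊆ : ∀ {z f} → z ∈ F → f ∈ F → f ⊆ g z → f ⊆ z
    extensive  : ∀ z → z ⊆ g z

identity-invariant : {n : ℕ} (F : Family n) → UnionClosed F → RisingInvariant F id
identity-invariant F closed = record
  { closed     = λ u∈F v∈F → toImage (closed (fromImage u∈F) (fromImage v∈F))
  ; absorbs    = λ z∈F f∈F → toImage (closed z∈F f∈F)
  ; injective  = λ _ _ e → e
  ; reflects-⊆ = λ _ _ f⊆z → f⊆z
  ; extensive  = λ _ → ⊆-refl
  }
  where
  toImage : ∀ {x} → x ∈ F → x ∈ map id F
  toImage = subst (_ ∈_) (sym (map-id F))
  fromImage : ∀ {x} → x ∈ map id F → x ∈ F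
  fromImage = subst (_ ∈_) (map-id F)

rise-invariant : {n : ℕ} (F : Family n) (g : Subset n → Subset n) (a : Fin n) →
  RisingInvariant F g → RisingInvariant F (rise (map g F) a ∘ g)
rise-invariant F g a I = record
  { closed     = subst UnionClosed image≡ (ρ-closed (closed I))
  ; absorbs    = λ {z} {f} z∈F f∈F → subst ((ρ (g z) ∪ f) ∈_) image≡
                   (ρ-∪-absorbed (closed I) (absorbs I z∈F f∈F))
  ; injective  = λ z∈F w∈F e → injective I z∈F w∈F (ρ-injective (∈-map⁺ g z∈F) (∈-map⁺ g w∈F) e)
  ; reflects-⊆ = λ z∈F f∈F f⊆ρgz → reflects-⊆ I z∈F f∈F (ρ-reflects-⊆ (absorbs I z∈F f∈F) f⊆ρgz)
  ; extensive  = λ z → ⊆-trans (extensive I z) (ρ-extensive (g z))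
  }
  where
  open RisingInvariant
  open OneRise (map g F) a
  image≡ : map ρ (map g F) ≡ map (ρ ∘ g) F
  image≡ = sym (map-∘ F)

risingFrom-invariant : {n : ℕ} (F : Family n) (w : List (Fin n)) (g : Subset n → Subset n) →
  RisingInvariant F g → RisingInvariant F (risingFrom F g w)
risingFrom-invariant F []      g I = I
risingFrom-invariant F (a ∷ w) g I =
  risingFrom-invariant F w (rise (map g F) a ∘ g) (rise-invariant F g a I)

risingW-invariant : {n : ℕ} (F : Family n) → UnionClosed F → (w : List (Fin n)) →
  RisingInvariant F (risingW F w)
risingW-invariant F closed w = risingFrom-invariant F w id (identity-invariant F closed)

theorem3p4 : (n : ℕ) (F : Family n) → UnionClosed F → ⋃ F ≡ ⊤ →
    ∀ {f} → f ∈ F →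
      ((∀ {g} → g ∈ F → f ⊆ g →
          f ⊆ risingW F (allFin n) g × risingW F (allFin n) g ∈ image (risingW F (allFin n)) F)
      × (∀ {g h} → g ∈ F → f ⊆ g → h ∈ F → f ⊆ h →
          risingW F (allFin n) g ≡ risingW F (allFin n) h → g ≡ h)
      × (∀ {η} → η ∈ image (risingW F (allFin n)) F → f ⊆ η →
          Σ (Subset n) (λ g → g ∈ F × f ⊆ g × risingW F (allFin n) g ≡ η)))
theorem3p4 n F closed _ {f} f∈F =
    (λ {g} g∈F f⊆g → ⊆-trans f⊆g (extensive g) , ∈-map⁺ φ g∈F)
  , (λ g∈F _ h∈F _ φg≡φh → injective g∈F h∈F φg≡φh)
  , preimage
  where
  φ = risingW F (allFin n)
  open RisingInvariant (risingW-invariant F closed (allFin n))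
  preimage : ∀ {η} → η ∈ image φ F → f ⊆ η → Σ (Subset n) (λ g → g ∈ F × f ⊆ g × φ g ≡ η)
  preimage η∈U f⊆η with ∈-map⁻ φ η∈U
  ... | g , g∈F , refl = g , g∈F , reflects-⊆ g∈F f∈F f⊆η , refl
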